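{- Let $q$ be a prime power, $n,r$ positive integers, and let $U_1,\ldots,U_r$ and $W_1,\ldots,W_r$ be $\mathbb{F}_q$-subspaces of $\mathbb{F}_{q^n}$ with $\sum_{i}\dim_{\mathbb{F}_q}(U_i)=\sum_i\dim_{\mathbb{F}_q}(W_i)=k\leq(r-1)n$. Let $U=U_1\times\cdots\times U_r$, $W=W_1\times\cdots\times W_r$, and suppose that the points $P_i=\langle\mathbf{e}_i\rangle_{\mathbb{F}_{q^n}}$, $i\in\{1,\ldots,r\}$, are the only points of weight greater than one in $L_U$ and in $L_W$. Then $U$ and $W$ are $\mathrm{\Gamma L}(r,q^n)$-equivalent if and only if there exist $\sigma\in S_r$, $\lambda_1,\ldots,\lambda_r\in\mathbb{F}_{q^n}^*$ and $\rho\in\mathrm{Aut}(\mathbb{F}_{q^n})$ such that $W_i=\lambda_iU_{\sigma(i)}^\rho$ for every $i$. In particular, in that case $\dim_{\mathbb{F}_q}(W_i)=\dim_{\mathbb{F}_q}(U_{\sigma(i)})$ for all $i$.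
   Context: $\mathbf{e}_i$ is the $i$-th standard basis vector of $\mathbb{F}_{q^n}^r$. For an $\mathbb{F}_q$-subspace $X$ of $\mathbb{F}_{q^n}^r$, $L_X=\{\langle\mathbf{x}\rangle_{\mathbb{F}_{q^n}}:\mathbf{x}\in X\setminus\{\mathbf{0}\}\}$ and $w_{L_X}(\langle\mathbf{v}\rangle_{\mathbb{F}_{q^n}})=\dim_{\mathbb{F}_q}(X\cap\langle\mathbf{v}\rangle_{\mathbb{F}_{q^n}})$. $U$ and $W$ are $\mathrm{\Gamma L}(r,q^n)$-equivalent if $\varphi(U)=W$ for some $\varphi\in\mathrm{\Gamma L}(r,q^n)=\mathrm{GL}(r,q^n)\rtimes\mathrm{Aut}(\mathbb{F}_{q^n})$. $U^\rho=\{u^\rho:u\in U\}$. -}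

module Defs where

open import Level using (0ℓ)
open import Data.Nat using (ℕ; zero; suc; _≤_) renaming (_+_ to _+ℕ_; _*_ to _*ℕ_; _^_ to _^ℕ_)
open import Data.Nat.Primality using (Prime)
open import Data.Fin using (Fin; zero; suc; _≟_)
open import Data.Fin.Permutation using (Permutation′; _⟨$⟩ʳ_)
open import Data.Vec using (Vec; lookup; tabulate; map; zipWith; replicate)
open import Data.Product using (Σ; ∃; ∃-syntax; _×_; _,_)
open import Relation.Binary.PropositionalEquality using (_≡_; _≢_)
open import Relation.Nullary using (¬_; Dec; yes; no)
open import Function.Bundles using (_↔_; _⇔_)
open import Algebra.Structures using (IsCommutativeRing)

IsPrimePower : ℕ → Set
IsPrimePower q = ∃[ p ] ∃[ m ] (Prime p × 1 ≤ m × q ≡ p ^ℕ m)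

sumFin : ∀ {r} → (Fin r → ℕ) → ℕ
sumFin {zero} f = 0
sumFin {suc r} f = f zero +ℕ sumFin (λ i → f (suc i))

record FiniteField (q n : ℕ) : Set₁ where
  field
    Carrier : Set
    _+_ _*_ : Carrier → Carrier → Carrier
    -_ : Carrier → Carrier
    0# 1# : Carrier
    isCommutativeRing : IsCommutativeRing _≡_ _+_ _*_ -_ 0# 1#
    0≢1 : 0# ≢ 1#
    inverse : ∀ x → x ≢ 0# → ∃[ y ] (x * y ≡ 1#)
    card : Carrier ↔ Fin (q ^ℕ n)

module Over {q n : ℕ} (K : FiniteField q n) where
  open FiniteField K public

  _^_ : Carrier → ℕ → Carrier
  x ^ zero = 1#
  x ^ suc m = x * (x ^ m)

  -- the subfield F_q of F_{q^n}: the elements fixed by x ↦ x^q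
  InFq : Carrier → Set
  InFq x = x ^ q ≡ x

  record Automorphism : Set where
    field
      ρ : Carrier → Carrier
      ρ⁻¹ : Carrier → Carrier
      ρ-+ : ∀ x y → ρ (x + y) ≡ ρ x + ρ y
      ρ-* : ∀ x y → ρ (x * y) ≡ ρ x * ρ y
      ρ-1 : ρ 1# ≡ 1#
      left : ∀ x → ρ⁻¹ (ρ x) ≡ x
      right : ∀ x → ρ (ρ⁻¹ x) ≡ x

  module LinAlg (V : Set) (_⊕_ : V → V → V) (𝟎 : V) (_·_ : Carrier → V → V) where

    lincomb : ∀ {d} → (Fin d → Carrier) → (Fin d → V) → V
    lincomb {zero} c b = 𝟎
    lincomb {suc d} c b = (c zero · b zero) ⊕ lincomb (λ j → c (suc j)) (λ j → b (suc j))

    IsFqSubspace : (V → Set) → Set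
    IsFqSubspace P = P 𝟎 × (∀ x y → P x → P y → P (x ⊕ y))
                         × (∀ c x → InFq c → P x → P (c · x))

    FqIndependent : ∀ {d} → (Fin d → V) → Set
    FqIndependent {d} b = ∀ (c : Fin d → Carrier) → (∀ j → InFq (c j))
                          → lincomb c b ≡ 𝟎 → ∀ j → c j ≡ 0#

    FqSpans : ∀ {d} → (V → Set) → (Fin d → V) → Set
    FqSpans {d} P b = ∀ v → P v → ∃[ c ] ((∀ j → InFq (c j)) × v ≡ lincomb c b)

    HasDim : (V → Set) → ℕ → Set
    HasDim P d = ∃[ b ] ((∀ j → P (b j)) × FqIndependent {d} b × FqSpans P b)

  module OnK = LinAlg Carrier _+_ 0# _*_

  module OnV (r : ℕ) = LinAlg (Vec Carrier r) (zipWith _+_) (replicate r 0#) (λ a v → map (a *_) v)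

  e : ∀ {r} → Fin r → Vec Carrier r
  e i = tabulate (λ j → δ (i ≟ j))
    where
      δ : ∀ {A : Set} → Dec A → Carrier
      δ (yes _) = 1#
      δ (no _) = 0#

  KSpan : ∀ {r} → Vec Carrier r → Vec Carrier r → Set
  KSpan v y = ∃[ a ] (y ≡ map (a *_) v)

  _∩_ : ∀ {A : Set} → (A → Set) → (A → Set) → A → Set
  (P ∩ Q) x = P x × Q x

  Weight : ∀ {r} → (Vec Carrier r → Set) → Vec Carrier r → ℕ → Set
  Weight {r} X v d = OnV.HasDim r (X ∩ KSpan v) d

  OnlyHeavyPointsAreEi : ∀ {r} → (Vec Carrier r → Set) → Set
  OnlyHeavyPointsAreEi {r} X =
    (∀ i → ∃[ d ] (2 ≤ d × Weight X (e i) d))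
    × (∀ x → X x → x ≢ replicate r 0# → ∀ d → Weight X x d → 2 ≤ d
         → ∃[ i ] (∀ y → KSpan x y ⇔ KSpan (e i) y))

  Prod : ∀ {r} → (Fin r → Carrier → Set) → Vec Carrier r → Set
  Prod U v = ∀ i → U i (lookup v i)

  Matrix : ℕ → Set
  Matrix r = Vec (Vec Carrier r) r

  dot : ∀ {r} → Vec Carrier r → Vec Carrier r → Carrier
  dot {zero} u v = 0#
  dot {suc r} (a Vec.∷ u) (b Vec.∷ v) = (a * b) + dot u v

  _⊛_ : ∀ {r} → Matrix r → Vec Carrier r → Vec Carrier r
  A ⊛ v = map (λ row → dot row v) A

  _⊠_ : ∀ {r} → Matrix r → Matrix r → Matrix r
  _⊠_ {r} A B = tabulate (λ i → tabulate (λ j → dot (lookup A i) (tabulate (λ k → lookup (lookup B k) j))))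

  Id : ∀ {r} → Matrix r
  Id = tabulate e

  IsInvertible : ∀ {r} → Matrix r → Set
  IsInvertible A = ∃[ B ] ((A ⊠ B ≡ Id) × (B ⊠ A ≡ Id))

  ΓLEquivalent : ∀ {r} → (Vec Carrier r → Set) → (Vec Carrier r → Set) → Set
  ΓLEquivalent {r} X Y = Σ (Matrix r) λ A → Σ Automorphism λ ρ → (IsInvertible A ×
    (∀ y → Y y ⇔ (∃[ x ] (X x × y ≡ A ⊛ map (Automorphism.ρ ρ) x))))

  ProductForm : ∀ {r} → (Fin r → Carrier → Set) → (Fin r → Carrier → Set) → Set
  ProductForm {r} U W = Σ (Permutation′ r) λ σ → Σ (Fin r → Carrier) λ λ′ → Σ Automorphism λ ρ → ((∀ i → λ′ i ≢ 0#) ×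
    (∀ i y → W i y ⇔ (∃[ u ] (U (σ ⟨$⟩ʳ i) u × y ≡ λ′ i * Automorphism.ρ ρ u))))

-- A ΓL-map φ(v) = A v^ρ is an injective semilinear map, so it preserves weights of points.
-- Hence it sends each heavy point ⟨e_j⟩ of L_U to a heavy point of L_W, which must be some
-- ⟨e_τ(j)⟩: every column of A is a multiple of a standard basis vector. Invertibility of A
-- makes τ a permutation and A monomial, and a monomial ΓL-map acts coordinatewise,
-- v ↦ (λ_i v_σ(i)^ρ)_i, which is exactly the product form. Conversely the product form is
-- realised by a monomial matrix, and the dimension statement follows because u ↦ λ u^ρ is
-- an injective semilinear map of F_{q^n}.
module Submission where

open import Defs
open import Data.Nat using (ℕ; _≤_; _∸_) renaming (_*_ to _*ℕ_)
open import Data.Fin using (Fin)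
open import Data.Fin.Permutation using (Permutation′; _⟨$⟩ʳ_)
open import Data.Product using (Σ; _×_)
open import Function.Bundles using (_⇔_)
open import Relation.Binary.PropositionalEquality using (_≡_)

open import Level using (0ℓ)
open import Algebra.Bundles using (CommutativeRing)
open import Data.Empty using (⊥-elim)
open import Data.Nat using (zero; suc; s≤s; NonZero)
open import Data.Nat.Primality using (prime⇒nonZero)
open import Data.Nat.Properties using (m^n≢0; <⇒≤)
open import Data.Fin using (zero; suc; _≟_)
open import Data.Fin.Properties using (any?; suc-injective)
open import Data.Fin.Permutation using (_⟨$⟩ˡ_; inverseˡ; inverseʳ; permutation)
open import Data.Product using (_,_; proj₁; proj₂; ∃-syntax)
open import Data.Vec using (Vec; []; _∷_; lookup; tabulate; map; zipWith; replicate)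
open import Data.Vec.Properties
  using (lookup-map; lookup-zipWith; lookup-replicate; lookup∘tabulate; tabulate∘lookup;
         tabulate-cong; map-∘; map-cong; map-id; map-replicate)
open import Function.Base using (_∘_; _∋_)
open import Function.Bundles using (mk⇔; Equivalence)
import Function.Properties.Equivalence as ⇔
open import Relation.Binary.PropositionalEquality
  using (_≢_; refl; sym; trans; cong; cong₂; subst; module ≡-Reasoning)
open import Relation.Nullary using (yes; no)

open Equivalence using (to; from)

Image : {A B : Set} → (A → B) → (A → Set) → B → Set
Image f P y = ∃[ x ] (P x × y ≡ f x)

primePower-nonZero : ∀ {q} → IsPrimePower q → NonZero q
primePower-nonZero (p , m , p-prime , _ , refl) = m^n≢0 p m {{prime⇒nonZero p-prime}}

module _ {q n : ℕ} (K : FiniteField q n) where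
  open Over K

  private
    ring : CommutativeRing 0ℓ 0ℓ
    ring = record { isCommutativeRing = isCommutativeRing }

  open CommutativeRing ring
    using (+-identityˡ; +-identityʳ; *-identityˡ; *-identityʳ; *-assoc; *-comm;
           zeroˡ; zeroʳ; distribˡ; +-group; semiring; commutativeSemiring)
  open import Algebra.Properties.Group +-group using (identityˡ-unique)
  open import Algebra.Properties.Semiring.Sum semiring
    using (sum; sum-cong-≗; sum-replicate-zero; ∑-comm; *-distribˡ-sum; *-distribʳ-sum)
  open import Algebra.Solver.Ring.NaturalCoefficients.Default commutativeSemiring
    using (solve; _:+_; _:*_; _:=_)

  infix 30 _⁻¹[_]

  _⁻¹[_] : (x : Carrier) → x ≢ 0# → Carrier
  x ⁻¹[ x≢0 ] = proj₁ (inverse x x≢0)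

  *-inverseʳ : ∀ x (x≢0 : x ≢ 0#) → x * x ⁻¹[ x≢0 ] ≡ 1#
  *-inverseʳ x x≢0 = proj₂ (inverse x x≢0)

  *-inverseˡ : ∀ x (x≢0 : x ≢ 0#) → x ⁻¹[ x≢0 ] * x ≡ 1#
  *-inverseˡ x x≢0 = trans (*-comm _ x) (*-inverseʳ x x≢0)

  *-cancelˡ : ∀ a {x y} → a ≢ 0# → a * x ≡ a * y → x ≡ y
  *-cancelˡ a {x} {y} a≢0 ax≡ay = begin
    x                      ≡⟨ sym (*-identityˡ x) ⟩
    1# * x                 ≡⟨ cong (_* x) (sym (*-inverseˡ a a≢0)) ⟩
    (a ⁻¹[ a≢0 ] * a) * x  ≡⟨ *-assoc _ a x ⟩
    a ⁻¹[ a≢0 ] * (a * x)  ≡⟨ cong (a ⁻¹[ a≢0 ] *_) ax≡ay ⟩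
    a ⁻¹[ a≢0 ] * (a * y)  ≡⟨ sym (*-assoc _ a y) ⟩
    (a ⁻¹[ a≢0 ] * a) * y  ≡⟨ cong (_* y) (*-inverseˡ a a≢0) ⟩
    1# * y                 ≡⟨ *-identityˡ y ⟩
    y                      ∎
    where open ≡-Reasoning

  1≢0 : 1# ≢ 0#
  1≢0 1≡0 = 0≢1 (sym 1≡0)

  1#-InFq : InFq 1#
  1#-InFq = 1^ q
    where
    1^ : ∀ m → 1# ^ m ≡ 1#
    1^ zero    = refl
    1^ (suc m) = trans (*-identityˡ _) (1^ m)

  0#-InFq : .{{NonZero q}} → InFq 0#
  0#-InFq = 0^ q
    where
    0^ : ∀ m → .{{NonZero m}} → 0# ^ m ≡ 0#
    0^ (suc m) = zeroˡ _

  module AutomorphismProperties (ϱ : Automorphism) where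
    open Automorphism ϱ

    ρ-0 : ρ 0# ≡ 0#
    ρ-0 = identityˡ-unique (ρ 0#) (ρ 0#) (trans (sym (ρ-+ 0# 0#)) (cong ρ (+-identityˡ 0#)))

    ρ-injective : ∀ {x y} → ρ x ≡ ρ y → x ≡ y
    ρ-injective {x} {y} ρx≡ρy = trans (sym (left x)) (trans (cong ρ⁻¹ ρx≡ρy) (left y))

    ρ-nonzero : ∀ {x} → x ≢ 0# → ρ x ≢ 0#
    ρ-nonzero x≢0 ρx≡0 = x≢0 (ρ-injective (trans ρx≡0 (sym ρ-0)))

    ρ-^ : ∀ x m → ρ (x ^ m) ≡ ρ x ^ m
    ρ-^ x zero    = ρ-1
    ρ-^ x (suc m) = trans (ρ-* x (x ^ m)) (cong (ρ x *_) (ρ-^ x m))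

    ρ-InFq : ∀ {c} → InFq c → InFq (ρ c)
    ρ-InFq {c} c∈Fq = trans (sym (ρ-^ c q)) (cong ρ c∈Fq)

    ρ⁻¹-InFq : ∀ {c} → InFq c → InFq (ρ⁻¹ c)
    ρ⁻¹-InFq {c} c∈Fq =
      ρ-injective (trans (ρ-^ (ρ⁻¹ c) q) (trans (cong (_^ q) (right c)) (trans c∈Fq (sym (right c)))))

  module SemilinearMaps {V V′ : Set}
      (_⊕_ : V → V → V) (𝟎 : V) (_·_ : Carrier → V → V)
      (_⊕′_ : V′ → V′ → V′) (𝟎′ : V′) (_·′_ : Carrier → V′ → V′) where
    private
      module S = LinAlg V _⊕_ 𝟎 _·_
      module S′ = LinAlg V′ _⊕′_ 𝟎′ _·′_

    record IsSemilinearEmbedding (ϱ : Automorphism) (f : V → V′) : Set where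
      field
        ⊕-homo : ∀ u v → f (u ⊕ v) ≡ f u ⊕′ f v
        ·-homo : ∀ c v → f (c · v) ≡ Automorphism.ρ ϱ c ·′ f v
        𝟎-homo : f 𝟎 ≡ 𝟎′
        injective : ∀ {u v} → f u ≡ f v → u ≡ v

    module _ {ϱ : Automorphism} {f : V → V′} (isEmbedding : IsSemilinearEmbedding ϱ f) where
      open Automorphism ϱ
      open AutomorphismProperties ϱ
      open IsSemilinearEmbedding isEmbedding

      lincomb-image : ∀ {d} (c : Fin d → Carrier) (b : Fin d → V) {c′ : Fin d → Carrier} {b′ : Fin d → V′}
        → (∀ j → ρ (c j) ≡ c′ j) → (∀ j → f (b j) ≡ b′ j)
        → f (S.lincomb c b) ≡ S′.lincomb c′ b′
      lincomb-image {zero}  _ _ _    _    = 𝟎-homo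
      lincomb-image {suc d} c b c≡c′ b≡b′ =
        trans (⊕-homo _ _)
              (cong₂ _⊕′_ (trans (·-homo _ _) (cong₂ _·′_ (c≡c′ zero) (b≡b′ zero)))
                          (lincomb-image (c ∘ suc) (b ∘ suc) (c≡c′ ∘ suc) (b≡b′ ∘ suc)))

      HasDim-image : (P : V → Set) (Q : V′ → Set) → (∀ y → Q y ⇔ Image f P y)
        → ∀ d → S.HasDim P d ⇔ S′.HasDim Q d
      HasDim-image P Q Q≡fP d = mk⇔ push pull
        where
        push : S.HasDim P d → S′.HasDim Q d
        push (b , b∈P , b-indep , b-spans) = f ∘ b , fb∈Q , fb-indep , fb-spans
          where
          fb∈Q : ∀ j → Q (f (b j))
          fb∈Q j = from (Q≡fP _) (b j , b∈P j , refl)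
          fb-indep : S′.FqIndependent (f ∘ b)
          fb-indep c c∈Fq lc≡𝟎′ j =
            trans (sym (right (c j)))
                  (trans (cong ρ (b-indep (ρ⁻¹ ∘ c) (ρ⁻¹-InFq ∘ c∈Fq) lc′≡𝟎 j)) ρ-0)
            where
            lc′≡𝟎 : S.lincomb (ρ⁻¹ ∘ c) b ≡ 𝟎
            lc′≡𝟎 = injective (trans (lincomb-image (ρ⁻¹ ∘ c) b (right ∘ c) (λ _ → refl))
                                     (trans lc≡𝟎′ (sym 𝟎-homo)))
          fb-spans : S′.FqSpans Q (f ∘ b)
          fb-spans y y∈Q with to (Q≡fP y) y∈Q
          ... | x , x∈P , refl with b-spans x x∈P
          ... | c , c∈Fq , refl = ρ ∘ c , ρ-InFq ∘ c∈Fq , lincomb-image c b (λ _ → refl) (λ _ → refl)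

        pull : S′.HasDim Q d → S.HasDim P d
        pull (b′ , b′∈Q , b′-indep , b′-spans) = b , b∈P , b-indep , b-spans
          where
          preimage : ∀ j → Image f P (b′ j)
          preimage j = to (Q≡fP (b′ j)) (b′∈Q j)
          b : Fin d → V
          b j = proj₁ (preimage j)
          b∈P : ∀ j → P (b j)
          b∈P j = proj₁ (proj₂ (preimage j))
          fb≡b′ : ∀ j → f (b j) ≡ b′ j
          fb≡b′ j = sym (proj₂ (proj₂ (preimage j)))
          b-indep : S.FqIndependent b
          b-indep c c∈Fq lc≡𝟎 j =
            ρ-injective (trans (b′-indep (ρ ∘ c) (ρ-InFq ∘ c∈Fq) lc′≡𝟎′ j) (sym ρ-0))
            where
            lc′≡𝟎′ : S′.lincomb (ρ ∘ c) b′ ≡ 𝟎′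
            lc′≡𝟎′ = trans (sym (lincomb-image c b (λ _ → refl) fb≡b′)) (trans (cong f lc≡𝟎) 𝟎-homo)
          b-spans : S.FqSpans P b
          b-spans x x∈P with b′-spans (f x) (from (Q≡fP (f x)) (x , x∈P , refl))
          ... | c , c∈Fq , fx≡ = ρ⁻¹ ∘ c , ρ⁻¹-InFq ∘ c∈Fq ,
                                 injective (trans fx≡ (sym (lincomb-image (ρ⁻¹ ∘ c) b (right ∘ c) fb≡b′)))

  open SemilinearMaps _+_ 0# _*_ _+_ 0# _*_
    using () renaming (IsSemilinearEmbedding to IsSemilinearEmbeddingᴷ; HasDim-image to HasDim-imageᴷ)

  scaled-automorphism-isSemilinearEmbedding : (ϱ : Automorphism) {c : Carrier} → c ≢ 0#
    → IsSemilinearEmbeddingᴷ ϱ (λ u → c * Automorphism.ρ ϱ u)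
  scaled-automorphism-isSemilinearEmbedding ϱ {c} c≢0 = record
    { ⊕-homo    = λ u v → trans (cong (c *_) (ρ-+ u v)) (distribˡ c _ _)
    ; ·-homo    = λ a v → trans (cong (c *_) (ρ-* a v))
                            (solve 3 (λ c x y → c :* (x :* y) := x :* (c :* y)) refl c _ _)
    ; 𝟎-homo    = trans (cong (c *_) ρ-0) (zeroʳ c)
    ; injective = ρ-injective ∘ *-cancelˡ c c≢0
    }
    where open Automorphism ϱ
          open AutomorphismProperties ϱ

  private
    variable
      m : ℕ

  infixl 6 _+ᵛ_
  infixr 7 _·ᵛ_

  _+ᵛ_ : Vec Carrier m → Vec Carrier m → Vec Carrier m
  _+ᵛ_ = zipWith _+_

  0ᵛ : Vec Carrier m
  0ᵛ {m} = replicate m 0#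

  _·ᵛ_ : Carrier → Vec Carrier m → Vec Carrier m
  a ·ᵛ v = map (a *_) v

  lookup-ext : {A : Set} {u v : Vec A m} → (∀ i → lookup u i ≡ lookup v i) → u ≡ v
  lookup-ext {u = u} {v} u≗v = trans (sym (tabulate∘lookup u)) (trans (tabulate-cong u≗v) (tabulate∘lookup v))

  ·ᵛ-assoc : ∀ a b (v : Vec Carrier m) → a ·ᵛ b ·ᵛ v ≡ (a * b) ·ᵛ v
  ·ᵛ-assoc a b v = trans (sym (map-∘ (a *_) (b *_) v)) (map-cong (λ x → sym (*-assoc a b x)) v)

  ·ᵛ-identityˡ : ∀ (v : Vec Carrier m) → 1# ·ᵛ v ≡ v
  ·ᵛ-identityˡ v = trans (map-cong *-identityˡ v) (map-id v)

  ·ᵛ-zeroˡ : ∀ (v : Vec Carrier m) → 0# ·ᵛ v ≡ 0ᵛ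
  ·ᵛ-zeroˡ v = lookup-ext λ i → trans (lookup-map i (0# *_) v) (trans (zeroˡ _) (sym (lookup-replicate i 0#)))

  ·ᵛ-zeroʳ : ∀ a → a ·ᵛ 0ᵛ {m} ≡ 0ᵛ
  ·ᵛ-zeroʳ {m} a = trans (map-replicate (a *_) 0# m) (cong (replicate m) (zeroʳ a))

  +ᵛ-identityˡ : ∀ (v : Vec Carrier m) → 0ᵛ +ᵛ v ≡ v
  +ᵛ-identityˡ v = lookup-ext λ i →
    trans (lookup-zipWith _+_ i 0ᵛ v) (trans (cong (_+ lookup v i) (lookup-replicate i 0#)) (+-identityˡ _))

  lookup-e-diag : ∀ (i : Fin m) → lookup (e i) i ≡ 1#
  lookup-e-diag i rewrite (lookup (e i) i ≡ _) ∋ lookup∘tabulate _ i with i ≟ i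
  ... | yes _  = refl
  ... | no i≢i = ⊥-elim (i≢i refl)

  lookup-e-offdiag : ∀ {i j : Fin m} → i ≢ j → lookup (e i) j ≡ 0#
  lookup-e-offdiag {i = i} {j} i≢j rewrite (lookup (e i) j ≡ _) ∋ lookup∘tabulate _ j with i ≟ j
  ... | yes i≡j = ⊥-elim (i≢j i≡j)
  ... | no _    = refl

  lookup-·ᵛ-e-diag : ∀ a (i : Fin m) → lookup (a ·ᵛ e i) i ≡ a
  lookup-·ᵛ-e-diag a i = trans (lookup-map i (a *_) (e i)) (trans (cong (a *_) (lookup-e-diag i)) (*-identityʳ a))

  lookup-·ᵛ-e-offdiag : ∀ a {i j : Fin m} → i ≢ j → lookup (a ·ᵛ e i) j ≡ 0#
  lookup-·ᵛ-e-offdiag a {i} {j} i≢j =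
    trans (lookup-map j (a *_) (e i)) (trans (cong (a *_) (lookup-e-offdiag i≢j)) (zeroʳ a))

  Prod-·ᵛ-e : (F : Fin m → Carrier → Set) → (∀ l → F l 0#) → ∀ {i y} → F i y → Prod F (y ·ᵛ e i)
  Prod-·ᵛ-e F F∋0 {i} {y} y∈Fi l with i ≟ l
  ... | yes refl = subst (F l) (sym (lookup-·ᵛ-e-diag y l)) y∈Fi
  ... | no i≢l   = subst (F l) (sym (lookup-·ᵛ-e-offdiag y i≢l)) (F∋0 l)

  KSpan-refl : ∀ (v : Vec Carrier m) → KSpan v v
  KSpan-refl v = 1# , sym (·ᵛ-identityˡ v)

  KSpan-scale : ∀ {c} → c ≢ 0# → ∀ (v y : Vec Carrier m) → KSpan v y ⇔ KSpan (c ·ᵛ v) y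
  KSpan-scale {c = c} c≢0 v y = mk⇔
    (λ { (a , refl) → a * c ⁻¹[ c≢0 ] , (begin
        a ·ᵛ v                        ≡⟨ cong (_·ᵛ v) (sym (*-identityʳ a)) ⟩
        (a * 1#) ·ᵛ v                 ≡⟨ cong (λ t → (a * t) ·ᵛ v) (sym (*-inverseˡ c c≢0)) ⟩
        (a * (c ⁻¹[ c≢0 ] * c)) ·ᵛ v  ≡⟨ cong (_·ᵛ v) (sym (*-assoc a _ c)) ⟩
        ((a * c ⁻¹[ c≢0 ]) * c) ·ᵛ v  ≡⟨ sym (·ᵛ-assoc _ c v) ⟩
        (a * c ⁻¹[ c≢0 ]) ·ᵛ c ·ᵛ v   ∎) })
    (λ { (a , refl) → a * c , ·ᵛ-assoc a c v })
    where open ≡-Reasoning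

  independent-head-nonzero : .{{NonZero q}} → ∀ {d} {b : Fin (suc d) → Vec Carrier m}
    → OnV.FqIndependent m b → b zero ≢ 0ᵛ
  independent-head-nonzero {m} {d} {b} b-indep b₀≡0 = 1≢0 (b-indep c c∈Fq lc≡0 zero)
    where
    c : Fin (suc d) → Carrier
    c zero    = 1#
    c (suc _) = 0#
    c∈Fq : ∀ j → InFq (c j)
    c∈Fq zero    = 1#-InFq
    c∈Fq (suc _) = 0#-InFq
    zero-coefficients : ∀ {d′} (b′ : Fin d′ → Vec Carrier m) → OnV.lincomb m (λ _ → 0#) b′ ≡ 0ᵛ
    zero-coefficients {zero}   _  = refl
    zero-coefficients {suc d′} b′ =
      trans (cong₂ _+ᵛ_ (·ᵛ-zeroˡ _) (zero-coefficients (b′ ∘ suc))) (+ᵛ-identityˡ 0ᵛ)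
    lc≡0 : OnV.lincomb m c b ≡ 0ᵛ
    lc≡0 = trans (cong₂ _+ᵛ_ (trans (cong (1# ·ᵛ_) b₀≡0) (·ᵛ-zeroʳ 1#)) (zero-coefficients (b ∘ suc)))
                 (+ᵛ-identityˡ 0ᵛ)

  entry : Matrix m → Fin m → Fin m → Carrier
  entry A i j = lookup (lookup A i) j

  matrix-ext : {A B : Matrix m} → (∀ i j → entry A i j ≡ entry B i j) → A ≡ B
  matrix-ext A≗B = lookup-ext λ i → lookup-ext (A≗B i)

  sum-single : ∀ (i : Fin m) (f : Fin m → Carrier) → (∀ k → k ≢ i → f k ≡ 0#) → sum f ≡ f i
  sum-single {suc m} zero f f-vanishes =
    trans (cong (f zero +_) (trans (sum-cong-≗ (λ k → f-vanishes (suc k) λ ())) (sum-replicate-zero m)))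
          (+-identityʳ _)
  sum-single {suc m} (suc i) f f-vanishes =
    trans (cong₂ _+_ (f-vanishes zero λ ())
                     (sum-single i (f ∘ suc) (λ k k≢i → f-vanishes (suc k) (k≢i ∘ suc-injective))))
          (+-identityˡ _)

  dot-sum : ∀ (u v : Vec Carrier m) → dot u v ≡ sum (λ k → lookup u k * lookup v k)
  dot-sum []      []      = refl
  dot-sum (a ∷ u) (b ∷ v) = cong ((a * b) +_) (dot-sum u v)

  ⊛-lookup : ∀ (A : Matrix m) v i → lookup (A ⊛ v) i ≡ sum (λ k → entry A i k * lookup v k)
  ⊛-lookup A v i = trans (lookup-map i _ A) (dot-sum (lookup A i) v)

  ⊠-entry : ∀ (A B : Matrix m) i j → entry (A ⊠ B) i j ≡ sum (λ k → entry A i k * entry B k j)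
  ⊠-entry A B i j = begin
    entry (A ⊠ B) i j
      ≡⟨ cong (λ row → lookup row j) (lookup∘tabulate _ i) ⟩
    lookup (tabulate λ j′ → dot (lookup A i) (column j′)) j
      ≡⟨ lookup∘tabulate _ j ⟩
    dot (lookup A i) (column j)
      ≡⟨ dot-sum (lookup A i) (column j) ⟩
    sum (λ k → entry A i k * lookup (column j) k)
      ≡⟨ sum-cong-≗ (λ k → cong (entry A i k *_) (lookup∘tabulate _ k)) ⟩
    sum (λ k → entry A i k * entry B k j)
      ∎
    where
    open ≡-Reasoning
    column : Fin _ → Vec Carrier _
    column j′ = tabulate λ k → entry B k j′

  ⊛-lookup-sparse : ∀ (A : Matrix m) {i j} → (∀ k → k ≢ j → entry A i k ≡ 0#)
    → ∀ v → lookup (A ⊛ v) i ≡ entry A i j * lookup v j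
  ⊛-lookup-sparse A {i} {j} row-vanishes v =
    trans (⊛-lookup A v i) (sum-single j _ λ k k≢j → trans (cong (_* lookup v k) (row-vanishes k k≢j)) (zeroˡ _))

  ⊛-e-lookup : ∀ (A : Matrix m) j k → lookup (A ⊛ e j) k ≡ entry A k j
  ⊛-e-lookup A j k = trans (⊛-lookup A (e j) k) (trans
    (sum-single j _ λ l l≢j → trans (cong (entry A k l *_) (lookup-e-offdiag (l≢j ∘ sym))) (zeroʳ _))
    (trans (cong (entry A k j *_) (lookup-e-diag j)) (*-identityʳ _)))

  Id-entry : ∀ (i j : Fin m) → entry Id i j ≡ lookup (e i) j
  Id-entry i j = cong (λ row → lookup row j) (lookup∘tabulate e i)

  Id-⊛ : ∀ (v : Vec Carrier m) → Id ⊛ v ≡ v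
  Id-⊛ v = lookup-ext λ i → trans
    (⊛-lookup-sparse Id (λ k k≢i → trans (Id-entry i k) (lookup-e-offdiag (k≢i ∘ sym))) v)
    (trans (cong (_* lookup v i) (trans (Id-entry i i) (lookup-e-diag i))) (*-identityˡ _))

  ⊠-⊛ : ∀ (B A : Matrix m) v → (B ⊠ A) ⊛ v ≡ B ⊛ (A ⊛ v)
  ⊠-⊛ B A v = lookup-ext coordinate
    where
    coordinate : ∀ i → lookup ((B ⊠ A) ⊛ v) i ≡ lookup (B ⊛ (A ⊛ v)) i
    coordinate i = begin
      lookup ((B ⊠ A) ⊛ v) i
        ≡⟨ ⊛-lookup (B ⊠ A) v i ⟩
      sum (λ j → entry (B ⊠ A) i j * lookup v j)
        ≡⟨ sum-cong-≗ (λ j → trans (cong (_* lookup v j) (⊠-entry B A i j))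
                                   (*-distribʳ-sum (lookup v j) (BA-terms j))) ⟩
      sum (λ j → sum (λ k → BA-terms j k * lookup v j))
        ≡⟨ ∑-comm (λ j k → BA-terms j k * lookup v j) ⟩
      sum (λ k → sum (λ j → BA-terms j k * lookup v j))
        ≡⟨ sum-cong-≗ (λ k → trans (sum-cong-≗ (λ j → *-assoc (entry B i k) (entry A k j) (lookup v j)))
                                   (sym (*-distribˡ-sum (entry B i k) (λ j → entry A k j * lookup v j)))) ⟩
      sum (λ k → entry B i k * sum (λ j → entry A k j * lookup v j))
        ≡⟨ sum-cong-≗ (λ k → cong (entry B i k *_) (sym (⊛-lookup A v k))) ⟩
      sum (λ k → entry B i k * lookup (A ⊛ v) k)
        ≡⟨ sym (⊛-lookup B (A ⊛ v) i) ⟩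
      lookup (B ⊛ (A ⊛ v)) i
        ∎
      where
      open ≡-Reasoning
      BA-terms : Fin _ → Fin _ → Carrier
      BA-terms j k = entry B i k * entry A k j

  dot-+ᵛ : ∀ (w u v : Vec Carrier m) → dot w (u +ᵛ v) ≡ dot w u + dot w v
  dot-+ᵛ []      []      []      = sym (+-identityˡ 0#)
  dot-+ᵛ (a ∷ w) (x ∷ u) (y ∷ v) = trans (cong ((a * (x + y)) +_) (dot-+ᵛ w u v))
    (solve 5 (λ a x y s t → a :* (x :+ y) :+ (s :+ t) := (a :* x :+ s) :+ (a :* y :+ t)) refl a x y _ _)

  dot-·ᵛ : ∀ c (w v : Vec Carrier m) → dot w (c ·ᵛ v) ≡ c * dot w v
  dot-·ᵛ c []      []      = sym (zeroʳ c)
  dot-·ᵛ c (a ∷ w) (x ∷ v) = trans (cong ((a * (c * x)) +_) (dot-·ᵛ c w v))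
    (solve 4 (λ c a x s → a :* (c :* x) :+ c :* s := c :* (a :* x :+ s)) refl c a x _)

  dot-0ᵛ : ∀ (w : Vec Carrier m) → dot w 0ᵛ ≡ 0#
  dot-0ᵛ []      = refl
  dot-0ᵛ (a ∷ w) = trans (cong₂ _+_ (zeroʳ a) (dot-0ᵛ w)) (+-identityˡ 0#)

  ⊛-+ᵛ : ∀ (A : Matrix m) u v → A ⊛ (u +ᵛ v) ≡ A ⊛ u +ᵛ A ⊛ v
  ⊛-+ᵛ A u v = lookup-ext λ i → trans (lookup-map i _ A) (trans (dot-+ᵛ (lookup A i) u v) (sym
    (trans (lookup-zipWith _+_ i (A ⊛ u) (A ⊛ v))
           (cong₂ _+_ (lookup-map i (λ row → dot row u) A) (lookup-map i (λ row → dot row v) A)))))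

  ⊛-·ᵛ : ∀ (A : Matrix m) c v → A ⊛ (c ·ᵛ v) ≡ c ·ᵛ A ⊛ v
  ⊛-·ᵛ A c v = lookup-ext λ i → trans (lookup-map i _ A) (trans (dot-·ᵛ c (lookup A i) v)
    (sym (trans (lookup-map i (c *_) (A ⊛ v)) (cong (c *_) (lookup-map i (λ row → dot row v) A)))))

  ⊛-0ᵛ : ∀ (A : Matrix m) → A ⊛ 0ᵛ ≡ 0ᵛ
  ⊛-0ᵛ A = lookup-ext λ i → trans (lookup-map i _ A) (trans (dot-0ᵛ (lookup A i)) (sym (lookup-replicate i 0#)))

  module _ (ϱ : Automorphism) where
    open Automorphism ϱ
    open AutomorphismProperties ϱ

    map-ρ-+ᵛ : ∀ (u v : Vec Carrier m) → map ρ (u +ᵛ v) ≡ map ρ u +ᵛ map ρ v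
    map-ρ-+ᵛ []      []      = refl
    map-ρ-+ᵛ (x ∷ u) (y ∷ v) = cong₂ _∷_ (ρ-+ x y) (map-ρ-+ᵛ u v)

    map-ρ-·ᵛ : ∀ c (v : Vec Carrier m) → map ρ (c ·ᵛ v) ≡ ρ c ·ᵛ map ρ v
    map-ρ-·ᵛ c []      = refl
    map-ρ-·ᵛ c (x ∷ v) = cong₂ _∷_ (ρ-* c x) (map-ρ-·ᵛ c v)

    map-ρ-0ᵛ : map ρ (0ᵛ {m}) ≡ 0ᵛ
    map-ρ-0ᵛ {m} = trans (map-replicate ρ 0# m) (cong (replicate m) ρ-0)

    map-ρ-e : ∀ (j : Fin m) → map ρ (e j) ≡ e j
    map-ρ-e j = lookup-ext λ k → trans (lookup-map k ρ (e j)) (ρ-lookup-e k)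
      where
      ρ-lookup-e : ∀ k → ρ (lookup (e j) k) ≡ lookup (e j) k
      ρ-lookup-e k with j ≟ k
      ... | yes refl = trans (cong ρ (lookup-e-diag j)) (trans ρ-1 (sym (lookup-e-diag j)))
      ... | no j≢k   = trans (cong ρ (lookup-e-offdiag j≢k)) (trans ρ-0 (sym (lookup-e-offdiag j≢k)))

  ΓLmap : Matrix m → Automorphism → Vec Carrier m → Vec Carrier m
  ΓLmap A ϱ v = A ⊛ map (Automorphism.ρ ϱ) v

  module VecMaps {m : ℕ} = SemilinearMaps (_+ᵛ_ {m}) 0ᵛ _·ᵛ_ (_+ᵛ_ {m}) 0ᵛ _·ᵛ_
  open VecMaps using ()
    renaming (IsSemilinearEmbedding to IsSemilinearEmbeddingᵛ; HasDim-image to HasDim-imageᵛ)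

  ΓLmap-isSemilinearEmbedding : ∀ {A B : Matrix m} (ϱ : Automorphism) → B ⊠ A ≡ Id
    → IsSemilinearEmbeddingᵛ ϱ (ΓLmap A ϱ)
  ΓLmap-isSemilinearEmbedding {A = A} {B} ϱ BA≡Id = record
    { ⊕-homo    = λ u v → trans (cong (A ⊛_) (map-ρ-+ᵛ ϱ u v)) (⊛-+ᵛ A _ _)
    ; ·-homo    = λ c v → trans (cong (A ⊛_) (map-ρ-·ᵛ ϱ c v)) (⊛-·ᵛ A _ _)
    ; 𝟎-homo    = trans (cong (A ⊛_) (map-ρ-0ᵛ ϱ)) (⊛-0ᵛ A)
    ; injective = λ {u} {v} φu≡φv →
        trans (sym (left-inverse u)) (trans (cong (map ρ⁻¹ ∘ (B ⊛_)) φu≡φv) (left-inverse v))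
    }
    where
    open Automorphism ϱ
    open ≡-Reasoning
    left-inverse : ∀ v → map ρ⁻¹ (B ⊛ ΓLmap A ϱ v) ≡ v
    left-inverse v = begin
      map ρ⁻¹ (B ⊛ (A ⊛ map ρ v))  ≡⟨ cong (map ρ⁻¹) (sym (⊠-⊛ B A (map ρ v))) ⟩
      map ρ⁻¹ ((B ⊠ A) ⊛ map ρ v)  ≡⟨ cong (λ M → map ρ⁻¹ (M ⊛ map ρ v)) BA≡Id ⟩
      map ρ⁻¹ (Id ⊛ map ρ v)       ≡⟨ cong (map ρ⁻¹) (Id-⊛ (map ρ v)) ⟩
      map ρ⁻¹ (map ρ v)            ≡⟨ sym (map-∘ ρ⁻¹ ρ v) ⟩
      map (ρ⁻¹ ∘ ρ) v              ≡⟨ map-cong left v ⟩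
      map (λ x → x) v              ≡⟨ map-id v ⟩
      v                            ∎

  Weight-respects-point : ∀ {X : Vec Carrier m → Set} {v w d} → (∀ y → KSpan v y ⇔ KSpan w y)
    → Weight X v d → Weight X w d
  Weight-respects-point ⟨v⟩≡⟨w⟩ (b , b∈ , b-indep , b-spans) =
    b , (λ j → proj₁ (b∈ j) , to (⟨v⟩≡⟨w⟩ _) (proj₂ (b∈ j))) , b-indep ,
    λ { y (y∈X , y∈⟨w⟩) → b-spans y (y∈X , from (⟨v⟩≡⟨w⟩ y) y∈⟨w⟩) }

  Weight-image : ∀ {ϱ f} → IsSemilinearEmbeddingᵛ ϱ f
    → ∀ {X Y : Vec Carrier m → Set} → (∀ y → Y y ⇔ Image f X y)
    → ∀ {v d} → Weight X v d → Weight Y (f v) d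
  Weight-image {ϱ = ϱ} {f} f-embedding {X} {Y} Y≡fX {v} {d} =
    to (HasDim-imageᵛ f-embedding (X ∩ KSpan v) (Y ∩ KSpan (f v)) point-image d)
    where
    open Automorphism ϱ
    open IsSemilinearEmbeddingᵛ f-embedding
    point-image : ∀ y → (Y ∩ KSpan (f v)) y ⇔ Image f (X ∩ KSpan v) y
    point-image y = mk⇔
      (λ { (y∈Y , a , y≡afv) → let (x , x∈X , y≡fx) = to (Y≡fX y) y∈Y in
           x , (x∈X , ρ⁻¹ a , injective (begin
             f x                  ≡⟨ sym y≡fx ⟩
             y                    ≡⟨ y≡afv ⟩
             a ·ᵛ f v             ≡⟨ cong (_·ᵛ f v) (sym (right a)) ⟩
             ρ (ρ⁻¹ a) ·ᵛ f v     ≡⟨ sym (·-homo (ρ⁻¹ a) v) ⟩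
             f (ρ⁻¹ a ·ᵛ v)       ∎)) , y≡fx })
      (λ { (x , (x∈X , a , refl) , y≡fx) → from (Y≡fX y) (_ , x∈X , y≡fx) , ρ a , trans y≡fx (·-homo a v) })
      where open ≡-Reasoning

  Weight-witness : .{{NonZero q}} → ∀ {X : Vec Carrier m → Set} {v d}
    → Weight X v d → 1 ≤ d → ∃[ x ] (X x × KSpan v x × x ≢ 0ᵛ)
  Weight-witness (b , b∈ , b-indep , _) (s≤s _) =
    b zero , proj₁ (b∈ zero) , proj₂ (b∈ zero) , independent-head-nonzero {b = b} b-indep

  heavy-point-image : .{{NonZero q}} → ∀ {ϱ f} → IsSemilinearEmbeddingᵛ ϱ f
    → ∀ {X Y : Vec Carrier m → Set} → (∀ y → Y y ⇔ Image f X y)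
    → OnlyHeavyPointsAreEi X → OnlyHeavyPointsAreEi Y
    → ∀ j → ∃[ i ] KSpan (e i) (f (e j))
  heavy-point-image {ϱ = ϱ} {f} f-embedding {X} {Y} Y≡fX (X-heavy , _) (_ , Y-heavy-only) j
    with X-heavy j
  -- e_j itself need not lie in X, so the heavy-point hypothesis on Y is applied to f x for a
  -- nonzero x ∈ X ∩ ⟨e_j⟩.
  ... | d , 2≤d , weight-ej with Weight-witness weight-ej (<⇒≤ 2≤d)
  ... | x , x∈X , (a , refl) , x≢0 = proj₁ fx-heavy , to (proj₂ fx-heavy (f (e j))) fej∈⟨fx⟩
    where
    open Automorphism ϱ
    open AutomorphismProperties ϱ
    open IsSemilinearEmbeddingᵛ f-embedding
    a≢0 : a ≢ 0#
    a≢0 a≡0 = x≢0 (trans (cong (_·ᵛ e j) a≡0) (·ᵛ-zeroˡ (e j)))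
    weight-fx : Weight Y (f x) d
    weight-fx = Weight-image f-embedding Y≡fX (Weight-respects-point (KSpan-scale a≢0 (e j)) weight-ej)
    fx≢0 : f x ≢ 0ᵛ
    fx≢0 fx≡0 = x≢0 (injective (trans fx≡0 (sym 𝟎-homo)))
    fx-heavy : ∃[ i ] (∀ y → KSpan (f x) y ⇔ KSpan (e i) y)
    fx-heavy = Y-heavy-only (f x) (from (Y≡fX (f x)) (x , x∈X , refl)) fx≢0 d weight-fx 2≤d
    fej∈⟨fx⟩ : KSpan (f x) (f (e j))
    fej∈⟨fx⟩ = subst (λ z → KSpan z (f (e j))) (sym (·-homo a (e j)))
      (to (KSpan-scale (ρ-nonzero a≢0) (f (e j)) (f (e j))) (KSpan-refl (f (e j))))

  monomial : (Fin m → Fin m) → (Fin m → Carrier) → Matrix m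
  monomial s c = tabulate λ i → c i ·ᵛ e (s i)

  monomial-entry : ∀ (s : Fin m → Fin m) c i k → entry (monomial s c) i k ≡ lookup (c i ·ᵛ e (s i)) k
  monomial-entry s c i k = cong (λ row → lookup row k) (lookup∘tabulate _ i)

  monomial-⊛ : ∀ (s : Fin m → Fin m) c v i → lookup (monomial s c ⊛ v) i ≡ c i * lookup v (s i)
  monomial-⊛ s c v i = trans
    (⊛-lookup-sparse (monomial s c)
      (λ k k≢si → trans (monomial-entry s c i k) (lookup-·ᵛ-e-offdiag (c i) (k≢si ∘ sym))) v)
    (cong (_* lookup v (s i)) (trans (monomial-entry s c i (s i)) (lookup-·ᵛ-e-diag (c i) (s i))))

  monomial-⊠-entry : ∀ (s t : Fin m → Fin m) c d i j
    → entry (monomial s c ⊠ monomial t d) i j ≡ entry (monomial (t ∘ s) (λ i → c i * d (s i))) i j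
  monomial-⊠-entry s t c d i j = begin
    entry (monomial s c ⊠ monomial t d) i j
      ≡⟨ ⊠-entry (monomial s c) (monomial t d) i j ⟩
    sum (λ k → entry (monomial s c) i k * entry (monomial t d) k j)
      ≡⟨ sum-single (s i) _ off-support ⟩
    entry (monomial s c) i (s i) * entry (monomial t d) (s i) j
      ≡⟨ cong₂ _*_ (trans (monomial-entry s c i (s i)) (lookup-·ᵛ-e-diag (c i) (s i))) (monomial-entry t d (s i) j) ⟩
    c i * lookup (d (s i) ·ᵛ e (t (s i))) j
      ≡⟨ cong (c i *_) (lookup-map j _ (e (t (s i)))) ⟩
    c i * (d (s i) * lookup (e (t (s i))) j)
      ≡⟨ sym (*-assoc (c i) _ _) ⟩
    (c i * d (s i)) * lookup (e (t (s i))) j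
      ≡⟨ sym (trans (monomial-entry (t ∘ s) _ i j) (lookup-map j _ (e (t (s i))))) ⟩
    entry (monomial (t ∘ s) (λ i → c i * d (s i))) i j
      ∎
    where
    open ≡-Reasoning
    off-support : ∀ k → k ≢ s i → entry (monomial s c) i k * entry (monomial t d) k j ≡ 0#
    off-support k k≢si =
      trans (cong (_* _) (trans (monomial-entry s c i k) (lookup-·ᵛ-e-offdiag (c i) (k≢si ∘ sym)))) (zeroˡ _)

  monomial-⊠ : ∀ (s t : Fin m → Fin m) c d
    → monomial s c ⊠ monomial t d ≡ monomial (t ∘ s) (λ i → c i * d (s i))
  monomial-⊠ s t c d = matrix-ext (monomial-⊠-entry s t c d)

  monomial-cong : ∀ {s s′ : Fin m → Fin m} {c c′} → (∀ i → s i ≡ s′ i) → (∀ i → c i ≡ c′ i)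
    → monomial s c ≡ monomial s′ c′
  monomial-cong s≗s′ c≗c′ = tabulate-cong λ i → cong₂ (λ a t → a ·ᵛ e t) (c≗c′ i) (s≗s′ i)

  monomial-identity : monomial (λ i → i) (λ _ → 1#) ≡ Id {m}
  monomial-identity = tabulate-cong λ i → ·ᵛ-identityˡ (e i)

  monomial-invertible : ∀ (σ : Permutation′ m) {c} → (∀ i → c i ≢ 0#)
    → IsInvertible (monomial (σ ⟨$⟩ʳ_) c)
  monomial-invertible σ {c} c≢0 = monomial (σ ⟨$⟩ˡ_) c⁻¹ , inverse-on-right , inverse-on-left
    where
    c⁻¹ : Fin _ → Carrier
    c⁻¹ k = c (σ ⟨$⟩ˡ k) ⁻¹[ c≢0 (σ ⟨$⟩ˡ k) ]
    cancels : ∀ {i k} → k ≡ i → c i * c k ⁻¹[ c≢0 k ] ≡ 1#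
    cancels refl = *-inverseʳ _ _
    inverse-on-right : monomial (σ ⟨$⟩ʳ_) c ⊠ monomial (σ ⟨$⟩ˡ_) c⁻¹ ≡ Id
    inverse-on-right = trans (monomial-⊠ (σ ⟨$⟩ʳ_) (σ ⟨$⟩ˡ_) c c⁻¹)
      (trans (monomial-cong {s′ = λ i → i} {c′ = λ _ → 1#} (λ i → inverseˡ σ) (λ i → cancels (inverseˡ σ)))
             monomial-identity)
    inverse-on-left : monomial (σ ⟨$⟩ˡ_) c⁻¹ ⊠ monomial (σ ⟨$⟩ʳ_) c ≡ Id
    inverse-on-left = trans (monomial-⊠ (σ ⟨$⟩ˡ_) (σ ⟨$⟩ʳ_) c⁻¹ c)
      (trans (monomial-cong {s′ = λ i → i} {c′ = λ _ → 1#} (λ i → inverseʳ σ) (λ i → *-inverseˡ _ _))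
             monomial-identity)

  ΓLmap-monomial-lookup : ∀ (s : Fin m → Fin m) c ϱ v i
    → lookup (ΓLmap (monomial s c) ϱ v) i ≡ c i * Automorphism.ρ ϱ (lookup v (s i))
  ΓLmap-monomial-lookup s c ϱ v i =
    trans (monomial-⊛ s c _ i) (cong (c i *_) (lookup-map (s i) (Automorphism.ρ ϱ) v))

  module ColumnMonomial {A B : Matrix m} (AB≡Id : A ⊠ B ≡ Id) (BA≡Id : B ⊠ A ≡ Id)
                        (column : ∀ j → ∃[ i ] KSpan (e i) (A ⊛ e j)) where
    τ : Fin m → Fin m
    τ j = proj₁ (column j)

    μ : Fin m → Carrier
    μ j = proj₁ (proj₂ (column j))

    entry-A : ∀ k j → entry A k j ≡ μ j * lookup (e (τ j)) k
    entry-A k j = trans (sym (⊛-e-lookup A j k))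
      (trans (cong (λ v → lookup v k) (proj₂ (proj₂ (column j)))) (lookup-map k (μ j *_) (e (τ j))))

    entry-A-on : ∀ j → entry A (τ j) j ≡ μ j
    entry-A-on j = trans (entry-A (τ j) j) (trans (cong (μ j *_) (lookup-e-diag (τ j))) (*-identityʳ _))

    entry-A-off : ∀ {k j} → k ≢ τ j → entry A k j ≡ 0#
    entry-A-off {k} {j} k≢τj =
      trans (entry-A k j) (trans (cong (μ j *_) (lookup-e-offdiag (k≢τj ∘ sym))) (zeroʳ _))

    ⊠≡Id-entry : ∀ (M N : Matrix m) → M ⊠ N ≡ Id
      → ∀ i j → sum (λ k → entry M i k * entry N k j) ≡ lookup (e i) j
    ⊠≡Id-entry M N MN≡Id i j =
      trans (sym (⊠-entry M N i j)) (trans (cong (λ P → entry P i j) MN≡Id) (Id-entry i j))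

    B-μ : ∀ j′ j → entry B j′ (τ j) * μ j ≡ lookup (e j′) j
    B-μ j′ j = begin
      entry B j′ (τ j) * μ j                 ≡⟨ cong (entry B j′ (τ j) *_) (sym (entry-A-on j)) ⟩
      entry B j′ (τ j) * entry A (τ j) j     ≡⟨ sym (sum-single (τ j) _ off-support) ⟩
      sum (λ k → entry B j′ k * entry A k j) ≡⟨ ⊠≡Id-entry B A BA≡Id j′ j ⟩
      lookup (e j′) j                        ∎
      where
      open ≡-Reasoning
      off-support : ∀ k → k ≢ τ j → entry B j′ k * entry A k j ≡ 0#
      off-support k k≢τj = trans (cong (entry B j′ k *_) (entry-A-off k≢τj)) (zeroʳ _)

    μ-nonzero : ∀ j → μ j ≢ 0#
    μ-nonzero j μj≡0 = 1≢0 (begin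
      1#                      ≡⟨ sym (lookup-e-diag j) ⟩
      lookup (e j) j          ≡⟨ sym (B-μ j j) ⟩
      entry B j (τ j) * μ j   ≡⟨ cong (entry B j (τ j) *_) μj≡0 ⟩
      entry B j (τ j) * 0#    ≡⟨ zeroʳ _ ⟩
      0#                      ∎)
      where open ≡-Reasoning

    τ-injective : ∀ {j₁ j₂} → τ j₁ ≡ τ j₂ → j₁ ≡ j₂
    τ-injective {j₁} {j₂} τj₁≡τj₂ with j₁ ≟ j₂
    ... | yes j₁≡j₂ = j₁≡j₂
    ... | no j₁≢j₂  = ⊥-elim (μ-nonzero j₁ (*-cancelˡ (entry B j₂ (τ j₂)) b≢0 (begin
      entry B j₂ (τ j₂) * μ j₁ ≡⟨ cong (λ i → entry B j₂ i * μ j₁) (sym τj₁≡τj₂) ⟩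
      entry B j₂ (τ j₁) * μ j₁ ≡⟨ B-μ j₂ j₁ ⟩
      lookup (e j₂) j₁         ≡⟨ lookup-e-offdiag (j₁≢j₂ ∘ sym) ⟩
      0#                       ≡⟨ sym (zeroʳ _) ⟩
      entry B j₂ (τ j₂) * 0#   ∎)))
      where
      open ≡-Reasoning
      b≢0 : entry B j₂ (τ j₂) ≢ 0#
      b≢0 b≡0 = 1≢0 (trans (sym (trans (B-μ j₂ j₂) (lookup-e-diag j₂)))
                           (trans (cong (_* μ j₂) b≡0) (zeroˡ _)))

    τ-surjective : ∀ i → ∃[ j ] (τ j ≡ i)
    τ-surjective i with any? (λ j → τ j ≟ i)
    ... | yes hit  = hit
    ... | no  miss = ⊥-elim (1≢0 (begin
      1#                                      ≡⟨ sym (lookup-e-diag i) ⟩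
      lookup (e i) i                          ≡⟨ sym (⊠≡Id-entry A B AB≡Id i i) ⟩
      sum (λ k → entry A i k * entry B k i)   ≡⟨ sum-cong-≗ {x = λ k → entry A i k * entry B k i} no-term ⟩
      sum {m} (λ _ → 0#)                      ≡⟨ sum-replicate-zero m ⟩
      0#                                      ∎))
      where
      open ≡-Reasoning
      no-term : ∀ k → entry A i k * entry B k i ≡ 0#
      no-term k = trans (cong (_* entry B k i) (entry-A-off (miss ∘ (k ,_) ∘ sym))) (zeroˡ _)

    σ : Permutation′ m
    σ = permutation (proj₁ ∘ τ-surjective) τ
      (λ j → τ-injective (proj₂ (τ-surjective (τ j)))) (proj₂ ∘ τ-surjective)

    A-monomial : A ≡ monomial (σ ⟨$⟩ʳ_) (μ ∘ (σ ⟨$⟩ʳ_))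
    A-monomial = matrix-ext λ i k → trans (entries i k) (sym (monomial-entry s (μ ∘ s) i k))
      where
      s : Fin m → Fin m
      s = σ ⟨$⟩ʳ_
      entries : ∀ i k → entry A i k ≡ lookup (μ (s i) ·ᵛ e (s i)) k
      entries i k with s i ≟ k
      ... | yes refl = trans (subst (λ i′ → entry A i′ (s i) ≡ μ (s i)) (inverseˡ σ) (entry-A-on (s i)))
                             (sym (lookup-·ᵛ-e-diag (μ (s i)) (s i)))
      ... | no si≢k  = trans (entry-A-off λ i≡τk → si≢k (trans (cong s i≡τk) (inverseʳ σ)))
                             (sym (lookup-·ᵛ-e-offdiag (μ (s i)) si≢k))

  Prod-image⇔componentwise : ∀ {U W : Fin m → Carrier → Set}
    → (σ : Permutation′ m) (c : Fin m → Carrier) (ϱ : Automorphism)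
    → (∀ i → U i 0#) → (∀ i → W i 0#)
    → (∀ y → Prod W y ⇔ Image (ΓLmap (monomial (σ ⟨$⟩ʳ_) c) ϱ) (Prod U) y)
      ⇔ (∀ i y → W i y ⇔ Image (λ u → c i * Automorphism.ρ ϱ u) (U (σ ⟨$⟩ʳ i)) y)
  Prod-image⇔componentwise {U = U} {W} σ c ϱ U∋0 W∋0 = mk⇔ componentwise product
    where
    open Automorphism ϱ
    s : Fin _ → Fin _
    s = σ ⟨$⟩ʳ_
    φ : Vec Carrier _ → Vec Carrier _
    φ = ΓLmap (monomial s c) ϱ
    φ-lookup : ∀ x i → lookup (φ x) i ≡ c i * ρ (lookup x (s i))
    φ-lookup = ΓLmap-monomial-lookup s c ϱ

    componentwise : (∀ y → Prod W y ⇔ Image φ (Prod U) y)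
      → ∀ i y → W i y ⇔ Image (λ u → c i * ρ u) (U (s i)) y
    componentwise W≡φU i y = mk⇔
      (λ y∈Wi → let (x , x∈U , yei≡φx) = to (W≡φU (y ·ᵛ e i)) (Prod-·ᵛ-e W W∋0 y∈Wi) in
        lookup x (s i) , x∈U (s i) ,
        trans (sym (lookup-·ᵛ-e-diag y i)) (trans (cong (λ v → lookup v i) yei≡φx) (φ-lookup x i)))
      (λ { (u , u∈U , refl) → subst (W i)
        (trans (φ-lookup (u ·ᵛ e (s i)) i) (cong (λ z → c i * ρ z) (lookup-·ᵛ-e-diag u (s i))))
        (from (W≡φU _) (u ·ᵛ e (s i) , Prod-·ᵛ-e U U∋0 u∈U , refl) i) })

    product : (∀ i y → W i y ⇔ Image (λ u → c i * ρ u) (U (s i)) y)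
      → ∀ y → Prod W y ⇔ Image φ (Prod U) y
    product Wi≡cUsi y = mk⇔ preimage image
      where
      preimage : Prod W y → Image φ (Prod U) y
      preimage y∈W = x , x∈U , lookup-ext y≗φx
        where
        coordinate : ∀ i → Image (λ u → c i * ρ u) (U (s i)) (lookup y i)
        coordinate i = to (Wi≡cUsi i (lookup y i)) (y∈W i)
        u : Fin _ → Carrier
        u i = proj₁ (coordinate i)
        x : Vec Carrier _
        x = tabulate (u ∘ (σ ⟨$⟩ˡ_))
        x∈U : Prod U x
        x∈U k = subst (U k) (sym (lookup∘tabulate _ k))
          (subst (λ k′ → U k′ (u (σ ⟨$⟩ˡ k))) (inverseʳ σ) (proj₁ (proj₂ (coordinate (σ ⟨$⟩ˡ k)))))
        y≗φx : ∀ i → lookup y i ≡ lookup (φ x) i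
        y≗φx i = trans (proj₂ (proj₂ (coordinate i))) (sym (trans (φ-lookup x i)
          (cong (λ z → c i * ρ z) (trans (lookup∘tabulate _ (s i)) (cong u (inverseˡ σ))))))
      image : Image φ (Prod U) y → Prod W y
      image (x , x∈U , refl) i = from (Wi≡cUsi i _) (lookup x (s i) , x∈U (s i) , φ-lookup x i)

  ProductForm⇒ΓLEquivalent : ∀ {U W : Fin m → Carrier → Set} → (∀ i → U i 0#) → (∀ i → W i 0#)
    → ProductForm U W → ΓLEquivalent (Prod U) (Prod W)
  ProductForm⇒ΓLEquivalent {U = U} {W} U∋0 W∋0 (σ , c , ϱ , c≢0 , Wi≡cUσi) =
    monomial (σ ⟨$⟩ʳ_) c , ϱ , monomial-invertible σ c≢0 ,
    from (Prod-image⇔componentwise {U = U} {W} σ c ϱ U∋0 W∋0) Wi≡cUσi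

  ΓLEquivalent⇒ProductForm : .{{NonZero q}} → ∀ {U W : Fin m → Carrier → Set}
    → (∀ i → U i 0#) → (∀ i → W i 0#)
    → OnlyHeavyPointsAreEi (Prod U) → OnlyHeavyPointsAreEi (Prod W)
    → ΓLEquivalent (Prod U) (Prod W) → ProductForm U W
  ΓLEquivalent⇒ProductForm {U = U} {W} U∋0 W∋0 U-heavy W-heavy (A , ϱ , (B , AB≡Id , BA≡Id) , W≡φU) =
    σ , μ ∘ (σ ⟨$⟩ʳ_) , ϱ , μ-nonzero ∘ (σ ⟨$⟩ʳ_) ,
    to (Prod-image⇔componentwise {U = U} {W} σ (μ ∘ (σ ⟨$⟩ʳ_)) ϱ U∋0 W∋0)
       (subst (λ M → ∀ y → Prod W y ⇔ Image (ΓLmap M ϱ) (Prod U) y) A-monomial W≡φU)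
    where
    φ-embedding : IsSemilinearEmbeddingᵛ ϱ (ΓLmap A ϱ)
    φ-embedding = ΓLmap-isSemilinearEmbedding {A = A} {B} ϱ BA≡Id
    column : ∀ j → ∃[ i ] KSpan (e i) (A ⊛ e j)
    column j = let (i , φej∈⟨ei⟩) = heavy-point-image φ-embedding W≡φU U-heavy W-heavy j in
      i , subst (λ v → KSpan (e i) (A ⊛ v)) (map-ρ-e ϱ j) φej∈⟨ei⟩
    open ColumnMonomial {A = A} {B} AB≡Id BA≡Id column

  ProductForm⇒HasDim : ∀ {U W : Fin m → Carrier → Set} → (pf : ProductForm U W)
    → ∀ i d → OnK.HasDim (W i) d ⇔ OnK.HasDim (U (proj₁ pf ⟨$⟩ʳ i)) d
  ProductForm⇒HasDim (σ , c , ϱ , c≢0 , Wi≡cUσi) i d =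
    ⇔.sym (HasDim-imageᴷ (scaled-automorphism-isSemilinearEmbedding ϱ (c≢0 i)) _ _ (Wi≡cUσi i) d)

proposition7p10 : (q n r : ℕ) → IsPrimePower q → 1 ≤ n → 1 ≤ r
    → (K : FiniteField q n)
    → let open Over K in
      (U W : Fin r → Carrier → Set)
    → (∀ i → OnK.IsFqSubspace (U i)) → (∀ i → OnK.IsFqSubspace (W i))
    → (k : ℕ) → (du dw : Fin r → ℕ)
    → (∀ i → OnK.HasDim (U i) (du i)) → (∀ i → OnK.HasDim (W i) (dw i))
    → sumFin du ≡ k → sumFin dw ≡ k → k ≤ (r ∸ 1) *ℕ n
    → OnlyHeavyPointsAreEi (Prod U) → OnlyHeavyPointsAreEi (Prod W)
    → (ΓLEquivalent (Prod U) (Prod W) ⇔ ProductForm U W)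
      × (ΓLEquivalent (Prod U) (Prod W)
         → Σ (Permutation′ r) λ σ → ∀ i d → OnK.HasDim (W i) d ⇔ OnK.HasDim (U (σ ⟨$⟩ʳ i)) d)
proposition7p10 q n r q-primePower _ _ K U W U-subspace W-subspace _ _ _ _ _ _ _ _ U-heavy W-heavy =
  mk⇔ ΓL⇒product (ProductForm⇒ΓLEquivalent K {U = U} {W} U∋0 W∋0) ,
  λ equivalent → let pf = ΓL⇒product equivalent in proj₁ pf , ProductForm⇒HasDim K {U = U} {W} pf
  where
  instance
    q≢0 : NonZero q
    q≢0 = primePower-nonZero q-primePower
  U∋0 : ∀ i → U i _
  U∋0 i = proj₁ (U-subspace i)
  W∋0 : ∀ i → W i _
  W∋0 i = proj₁ (W-subspace i)
  open Over K using (Prod; ΓLEquivalent; ProductForm)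
  ΓL⇒product : ΓLEquivalent (Prod U) (Prod W) → ProductForm U W
  ΓL⇒product = ΓLEquivalent⇒ProductForm K {U = U} {W} U∋0 W∋0 U-heavy W-heavy
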